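{- Let $x\in\{0,1\}^w$, let $j$ be an integer with $0\le j\le w-\log d(x,S)$, and let $p=x[0\..j)$. Then at least one of $p$, $p+1$, $p-1$ belongs to $\mathrm{Pref}(S)$.
   Context: Let $S$ be a nonempty set of binary strings of length $w$, identified with integers in $[0,2^w)$ so that lexicographic and numeric order coincide. $\mathrm{Pref}(S)$ is the set of prefixes of elements of $S$; $x[0\..j)$ is the prefix of $x$ of length $j$. For a string $p$, $p+1$ and $p-1$ denote the strings of length $|p|$ immediately after and before $p$ in lexicographic order (undefined, $\bot$, if they do not exist). For $x$, $x^-=\max\{y\in S\mid y<x\}$, $x^+=\min\{y\in S\mid y\ge x\}$, and $d(x,S)=\min\{x^+-x,\,x-x^-\}$; if only one of $x^\pm$ exists, $d(x,S)$ is the distance from $x$ to that one. Logarithms are binary, with $\log z=1$ whenever $z<2$. -}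

module Defs where

open import Level using (0ℓ)
open import Data.Nat using (ℕ; zero; suc; _+_; _∸_; _^_; _≤_; _<_; _⊓_; NonZero)
open import Data.Nat.DivMod using (_/_)
open import Data.Nat.Properties using (m^n≢0)
open import Data.Product using (Σ; _×_; ∃)
open import Data.Sum using (_⊎_)
open import Relation.Binary.PropositionalEquality using (_≡_)
open import Relation.Unary using (Pred)

-- Binary strings of length w are identified with naturals in [0, 2^w).
-- A set S of such strings is a predicate on ℕ.

prefix : (w : ℕ) → ℕ → ℕ → ℕ
prefix w x j = _/_ x (2 ^ (w ∸ j)) {{m^n≢0 2 (w ∸ j)}}

InPref : (w : ℕ) → Pred ℕ 0ℓ → (j q : ℕ) → Set
InPref w S j q = j ≤ w × ∃ λ y → S y × prefix w y j ≡ q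

IsPredOf : Pred ℕ 0ℓ → ℕ → ℕ → Set
IsPredOf S x y = S y × y < x × (∀ z → S z → z < x → z ≤ y)

IsSuccOf : Pred ℕ 0ℓ → ℕ → ℕ → Set
IsSuccOf S x y = S y × x ≤ y × (∀ z → S z → x ≤ z → y ≤ z)

data Dist (S : Pred ℕ 0ℓ) (x : ℕ) : ℕ → Set where
  both     : ∀ {a b} → IsPredOf S x a → IsSuccOf S x b → Dist S x ((b ∸ x) ⊓ (x ∸ a))
  onlySucc : ∀ {b} → (∀ z → S z → x ≤ z) → IsSuccOf S x b → Dist S x (b ∸ x)
  onlyPred : ∀ {a} → (∀ z → S z → z < x) → IsPredOf S x a → Dist S x (x ∸ a)

-- LogLe z k  means  log z ≤ k, with the convention log z = 1 for z < 2
-- and log z = log₂ z otherwise (so for z ≥ 2: log₂ z ≤ k ⇔ z ≤ 2^k).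
LogLe : ℕ → ℕ → Set
LogLe z k = (z < 2 × 1 ≤ k) ⊎ (2 ≤ z × z ≤ 2 ^ k)

module Submission where

open import Defs
open import Level using (0ℓ)
open import Data.Nat using (ℕ; _+_; _*_; _∸_; _^_; _≤_; _<_; _/_; NonZero)
open import Data.Nat.Properties
open import Data.Nat.DivMod using (/-monoˡ-≤; m/n≡1+[m∸n]/n; m<n*o⇒m/o<n)
open import Data.Product using (_×_; ∃; _,_)
open import Data.Sum using (_⊎_; inj₁; inj₂)
open import Relation.Unary using (Pred)
open import Relation.Binary.PropositionalEquality

-- Some y ∈ S lies within d(x,S) ≤ 2^(w-j) of x. Dividing by 2^(w-j), two numbers at
-- distance at most the divisor have quotients that are equal or adjacent, so the
-- length-j prefix of y is p, p+1 or p-1.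

m∸n≤o⇒m≤n+o : ∀ m n {o} → m ∸ n ≤ o → m ≤ n + o
m∸n≤o⇒m≤n+o m n m∸n≤o = ≤-trans (m≤n+m∸n m n) (+-monoʳ-≤ n m∸n≤o)

[m+n]/n≡m/n+1 : ∀ m n .{{_ : NonZero n}} → (m + n) / n ≡ m / n + 1
[m+n]/n≡m/n+1 m n = begin
  (m + n) / n           ≡⟨ m/n≡1+[m∸n]/n (m≤n+m n m) ⟩
  1 + (m + n ∸ n) / n   ≡⟨ cong (λ k → 1 + k / n) (m+n∸n≡m m n) ⟩
  1 + m / n             ≡⟨ +-comm 1 (m / n) ⟩
  m / n + 1             ∎
  where open ≡-Reasoning

/-adjacent : ∀ {m n o} .{{_ : NonZero o}} → m ≤ n → n ≤ m + o →
             n / o ≡ m / o ⊎ n / o ≡ m / o + 1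
/-adjacent {m} {n} {o} m≤n n≤m+o with m≤n⇒m<n∨m≡n (/-monoˡ-≤ o m≤n)
... | inj₂ m/o≡n/o = inj₁ (sym m/o≡n/o)
... | inj₁ m/o<n/o = inj₂ (≤-antisym n/o≤m/o+1 (subst (_≤ n / o) (+-comm 1 (m / o)) m/o<n/o))
  where
  n/o≤m/o+1 : n / o ≤ m / o + 1
  n/o≤m/o+1 = subst (n / o ≤_) ([m+n]/n≡m/n+1 m o) (/-monoˡ-≤ o n≤m+o)

Near : ℕ → ℕ → ℕ → Set
Near B x y = (x ≤ y × y ≤ x + B) ⊎ (y ≤ x × x ≤ y + B)

Near-mono : ∀ {δ B x y} → δ ≤ B → Near δ x y → Near B x y
Near-mono δ≤B (inj₁ (x≤y , y≤x+δ)) = inj₁ (x≤y , ≤-trans y≤x+δ (+-monoʳ-≤ _ δ≤B))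
Near-mono δ≤B (inj₂ (y≤x , x≤y+δ)) = inj₂ (y≤x , ≤-trans x≤y+δ (+-monoʳ-≤ _ δ≤B))

Near⇒/-adjacent : ∀ {B x y} .{{_ : NonZero B}} → Near B x y →
                  y / B ≡ x / B ⊎ y / B ≡ x / B + 1 ⊎ x / B ≡ y / B + 1
Near⇒/-adjacent (inj₁ (x≤y , y≤x+B)) with /-adjacent x≤y y≤x+B
... | inj₁ same = inj₁ same
... | inj₂ next = inj₂ (inj₁ next)
Near⇒/-adjacent (inj₂ (y≤x , x≤y+B)) with /-adjacent y≤x x≤y+B
... | inj₁ same = inj₁ (sym same)
... | inj₂ prev = inj₂ (inj₂ prev)

Dist⇒∃-Near : ∀ {S : Pred ℕ 0ℓ} {x δ} → Dist S x δ → ∃ λ y → S y × Near δ x y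
Dist⇒∃-Near {x = x} (both {a} {b} (Sa , a<x , _) (Sb , x≤b , _)) with ⊓-sel (b ∸ x) (x ∸ a)
... | inj₁ δ≡b∸x = b , Sb , inj₁ (x≤b , m∸n≤o⇒m≤n+o b x (≤-reflexive (sym δ≡b∸x)))
... | inj₂ δ≡x∸a = a , Sa , inj₂ (<⇒≤ a<x , m∸n≤o⇒m≤n+o x a (≤-reflexive (sym δ≡x∸a)))
Dist⇒∃-Near {x = x} (onlySucc {b} _ (Sb , x≤b , _)) = b , Sb , inj₁ (x≤b , m∸n≤o⇒m≤n+o b x ≤-refl)
Dist⇒∃-Near {x = x} (onlyPred {a} _ (Sa , a<x , _)) = a , Sa , inj₂ (<⇒≤ a<x , m∸n≤o⇒m≤n+o x a ≤-refl)

LogLe⇒≤2^ : ∀ {z k} → LogLe z k → z ≤ 2 ^ k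
LogLe⇒≤2^ {k = k} (inj₁ (z<2 , _)) = ≤-trans (≤-pred z<2) (m^n>0 2 k)
LogLe⇒≤2^ (inj₂ (_ , z≤2^k)) = z≤2^k

prefix<2^ : ∀ {w y j} → y < 2 ^ w → j ≤ w → prefix w y j < 2 ^ j
prefix<2^ {w} {y} {j} y<2^w j≤w =
  m<n*o⇒m/o<n {{m^n≢0 2 (w ∸ j)}} (subst (y <_) 2^w≡2^j*2^[w∸j] y<2^w)
  where
  2^w≡2^j*2^[w∸j] : 2 ^ w ≡ 2 ^ j * 2 ^ (w ∸ j)
  2^w≡2^j*2^[w∸j] = trans (cong (2 ^_) (sym (m+[n∸m]≡n j≤w))) (^-distribˡ-+-* 2 j (w ∸ j))

lemma2 : (w : ℕ) (S : Pred ℕ 0ℓ) → (∀ y → S y → y < 2 ^ w) → ∃ S →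
         (x : ℕ) → x < 2 ^ w → (δ : ℕ) → Dist S x δ →
         (j : ℕ) → j ≤ w → LogLe δ (w ∸ j) →
         InPref w S j (prefix w x j)
         ⊎ (prefix w x j + 1 < 2 ^ j × InPref w S j (prefix w x j + 1))
         ⊎ (1 ≤ prefix w x j × InPref w S j (prefix w x j ∸ 1))
lemma2 w S S<2^w _ x _ δ dist j j≤w logδ with Dist⇒∃-Near dist
... | y , Sy , near
  with Near⇒/-adjacent {{m^n≢0 2 (w ∸ j)}} (Near-mono (LogLe⇒≤2^ logδ) near)
...   | inj₁ same = inj₁ (j≤w , y , Sy , same)
...   | inj₂ (inj₁ next) =
  inj₂ (inj₁ (subst (_< 2 ^ j) next (prefix<2^ (S<2^w y Sy) j≤w) , j≤w , y , Sy , next))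
...   | inj₂ (inj₂ prev) =
  inj₂ (inj₂ (subst (1 ≤_) (sym prev) (m≤n+m 1 _) , j≤w , y , Sy ,
              sym (trans (cong (_∸ 1) prev) (m+n∸n≡m _ 1))))
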